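{- For $n\geq1$, $$L_{n+1}^E(x)=2nxL_n^E(x)+2x(1-x)\frac{d}{dx}L_n^E(x)+xL_n^O(x),$$ $$L_{n+1}^O(x)=((2n-1)x+1)L_n^O(x)+2x(1-x)\frac{d}{dx}L_n^O(x)+L_n^E(x),$$ with $L_1^E(x)=0$ and $L_1^O(x)=1$.
   Context: A Stirling permutation of order $n$ is a permutation $\sigma=\sigma_1\sigma_2\cdots\sigma_{2n}$ of the multiset $\{1,1,2,2,\ldots,n,n\}$ such that for each $i$, all entries between the two occurrences of $i$ are larger than $i$; $\mathcal{Q}_n$ denotes the set of these. The ascent-plateau number is ${\rm ap}(\sigma)=\#\{i\in[2,2n-1]:\sigma_{i-1}<\sigma_i=\sigma_{i+1}\}$. Let $\mathcal{Q}_n^+=\{\sigma\in\mathcal{Q}_n:\sigma_1<\sigma_2\}$, $\mathcal{Q}_n^-=\{\sigma\in\mathcal{Q}_n:\sigma_1=\sigma_2\}$, $L_n^E(x)=\sum_{\sigma\in\mathcal{Q}_n^+}x^{{\rm ap}(\sigma)}$ and $L_n^O(x)=\sum_{\sigma\in\mathcal{Q}_n^- }x^{{\rm ap}(\sigma)}$. (Equivalently, with ${\rm fap}(\sigma)=2{\rm ap}(\sigma)+1$ if $\sigma_1=\sigma_2$ and $2{\rm ap}(\sigma)$ otherwise, $\sum_{\sigma\in\mathcal{Q}_n}x^{{\rm fap}(\sigma)}=L_n^E(x^2)+xL_n^O(x^2)$.) -}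

module Defs where

open import Data.Nat using (ℕ; zero; suc; _+_; _*_; _<ᵇ_; _≡ᵇ_)
open import Data.Bool using (Bool; true; false; _∧_; if_then_else_; not)
open import Data.List using (List; []; _∷_; map; concatMap; upTo; filter; length)
open import Relation.Binary.PropositionalEquality using (_≡_)

all : {A : Set} → (A → Bool) → List A → Bool
all p []      = true
all p (x ∷ xs) = p x ∧ all p xs

any : {A : Set} → (A → Bool) → List A → Bool
any p []      = false
any p (x ∷ xs) = if p x then true else any p xs
open import Data.Integer as ℤ using (ℤ; +_)
open import Relation.Nullary.Decidable using (does)
open import Data.Bool.Properties using (T?)

takeWhileB : {A : Set} → (A → Bool) → List A → List A
takeWhileB p []       = []
takeWhileB p (x ∷ xs) = if p x then x ∷ takeWhileB p xs else []

words : ℕ → ℕ → List (List ℕ)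
words n zero    = [] ∷ []
words n (suc m) = concatMap (λ w → map (λ a → a ∷ w) (map suc (upTo n))) (words n m)

occ : ℕ → List ℕ → ℕ
occ i []      = 0
occ i (a ∷ w) = (if i ≡ᵇ a then 1 else 0) + occ i w

isMultisetPerm : ℕ → List ℕ → Bool
isMultisetPerm n w = all (λ i → occ i w ≡ᵇ 2) (map suc (upTo n))

stirlingCond : List ℕ → Bool
stirlingCond []      = true
stirlingCond (a ∷ w) =
  (if any (λ b → b ≡ᵇ a) w
     then all (λ b → a <ᵇ b) (takeWhileB (λ b → not (b ≡ᵇ a)) w)
     else true)
  ∧ stirlingCond w

isStirling : ℕ → List ℕ → Bool
isStirling n w = isMultisetPerm n w ∧ stirlingCond w

Q : ℕ → List (List ℕ)
Q n = filter (λ w → T? (isStirling n w)) (words n (2 * n))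

ap : List ℕ → ℕ
ap (a ∷ b ∷ c ∷ w) = (if (a <ᵇ b) ∧ (b ≡ᵇ c) then 1 else 0) + ap (b ∷ c ∷ w)
ap _               = 0

firstAsc : List ℕ → Bool
firstAsc (a ∷ b ∷ _) = a <ᵇ b
firstAsc _           = false

firstPlat : List ℕ → Bool
firstPlat (a ∷ b ∷ _) = a ≡ᵇ b
firstPlat _           = false

-- Polynomials with integer coefficients, as coefficient sequences
-- (p k = coefficient of x^k).  Equality of polynomials = pointwise equality.

Poly : Set
Poly = ℕ → ℤ

_⊕_ : Poly → Poly → Poly
(p ⊕ q) k = p k ℤ.+ q k
infixl 6 _⊕_

_⊖_ : Poly → Poly → Poly
(p ⊖ q) k = p k ℤ.- q k
infixl 6 _⊖_

_·_ : ℤ → Poly → Poly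
(c · p) k = c ℤ.* p k
infixr 7 _·_

X* : Poly → Poly
X* p zero    = + 0
X* p (suc k) = p k

D : Poly → Poly
D p k = + (suc k) ℤ.* p (suc k)

zeroP : Poly
zeroP _ = + 0

oneP : Poly
oneP zero    = + 1
oneP (suc _) = + 0

_≗P_ : Poly → Poly → Set
p ≗P q = ∀ k → p k ≡ q k
infix 4 _≗P_

-- L_n^E(x) = Σ_{σ ∈ Q_n^+} x^{ap σ},  L_n^O(x) = Σ_{σ ∈ Q_n^-} x^{ap σ}

countWith : (List ℕ → Bool) → List (List ℕ) → ℕ → ℕ
countWith P ws k = length (filter (λ w → T? (P w ∧ (ap w ≡ᵇ k))) ws)

LE : ℕ → Poly
LE n k = + countWith firstAsc (Q n) k

LO : ℕ → Poly
LO n k = + countWith firstPlat (Q n) k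

module Submission where

-- Every Stirling permutation of order n + 1 arises exactly once by inserting the plateau
-- (n+1)(n+1) into one of the 2n + 1 gaps of a Stirling permutation σ of order n.  Inserting
-- it in front of σ creates the initial plateau and keeps ap.  Behind the first letter there
-- are 2n gaps: the two gaps just before and just inside each ascent-plateau keep ap, the
-- others raise it by one.  Which of Q⁺ and Q⁻ the result lies in depends only on the gap
-- and on whether σ₁ < σ₂, so each σ contributes monomials that are a linear function of its
-- own weight, and summing over Q_n yields the recurrences.

open import Defs
open import Level using (0ℓ)
open import Algebra.Bundles using (CommutativeMonoid)
open import Data.Nat as ℕ using (ℕ; zero; suc; _<_; _≤_; _∸_; z≤n; s≤s; _<ᵇ_; _≡ᵇ_)
import Data.Nat.Properties as ℕ
import Data.Nat.Tactic.RingSolver as ℕ-Solver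
import Algebra.Construct.Pointwise ℕ as Pointwise
open import Data.Integer as ℤ using (ℤ; +_; _+_; _*_; _-_)
import Data.Integer.Properties as ℤ
open import Data.Integer.Tactic.RingSolver using (solve-∀)
open import Data.Bool using (Bool; true; false; _∧_; if_then_else_; not)
open import Data.Bool.Properties using (T-≡; T?; ¬-not; ∧-zeroʳ; ∧-conicalˡ; ∧-conicalʳ)
open import Data.List using (List; []; _∷_; _++_; map; foldr; concatMap; length; upTo; drop)
import Data.List.Properties as List
open import Data.List.Relation.Unary.Any using (here; there)
open import Data.List.Relation.Unary.All as All using (All; []; _∷_)
open import Data.List.Relation.Unary.All.Properties using (All¬⇒¬Any)
open import Data.List.Relation.Unary.AllPairs using ([]; _∷_)
open import Data.List.Relation.Unary.Unique.Propositional using (Unique)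
import Data.List.Relation.Unary.Unique.Propositional.Properties as Unique
open import Data.List.Membership.Propositional using (_∈_; lose; find)
open import Data.List.Membership.Propositional.Properties
open import Data.List.Membership.Propositional.Properties.WithK using (unique∧set⇒bag)
open import Data.List.Relation.Binary.BagAndSetEquality using (∼bag⇒↭)
open import Data.List.Relation.Binary.Permutation.Propositional using (_↭_; ↭⇒↭ₛ′)
import Data.List.Relation.Binary.Permutation.Propositional.Properties as ↭
open import Data.Sum using (_⊎_; inj₁; inj₂)
open import Data.Product using (_×_; _,_; proj₁; proj₂; ∃; ∃₂)
open import Data.Empty using (⊥; ⊥-elim)
open import Data.Unit using (⊤; tt)
open import Function using (_∘_; id)
open import Function.Bundles using (mk⇔; module Equivalence)
open Equivalence using (to; from)
open import Relation.Nullary using (yes; no)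
open import Relation.Binary.PropositionalEquality using (_≡_; _≢_; refl; sym; trans; cong; cong₂; subst)

≡ᵇ-refl : ∀ m → (m ≡ᵇ m) ≡ true
≡ᵇ-refl m = to T-≡ (ℕ.≡⇒≡ᵇ m m refl)

≡ᵇ-false : ∀ {m n} → m ≢ n → (m ≡ᵇ n) ≡ false
≡ᵇ-false m≢n = ¬-not (λ eq → m≢n (ℕ.≡ᵇ⇒≡ _ _ (from T-≡ eq)))

≡ᵇ-sound : ∀ {m n} → (m ≡ᵇ n) ≡ true → m ≡ n
≡ᵇ-sound eq = ℕ.≡ᵇ⇒≡ _ _ (from T-≡ eq)

<ᵇ-true : ∀ {m n} → m < n → (m <ᵇ n) ≡ true
<ᵇ-true m<n = to T-≡ (ℕ.<⇒<ᵇ m<n)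

<ᵇ-false : ∀ {m n} → n ≤ m → (m <ᵇ n) ≡ false
<ᵇ-false n≤m = ¬-not (λ eq → ℕ.≤⇒≯ n≤m (ℕ.<ᵇ⇒< _ _ (from T-≡ eq)))

<ᵇ-sound : ∀ {m n} → (m <ᵇ n) ≡ true → m < n
<ᵇ-sound eq = ℕ.<ᵇ⇒< _ _ (from T-≡ eq)

-- Polynomials

polyMonoid : CommutativeMonoid 0ℓ 0ℓ
polyMonoid = Pointwise.commutativeMonoid ℤ.+-0-commutativeMonoid

open CommutativeMonoid polyMonoid using (setoid; isEquivalence; isCommutativeMonoid)
  renaming (sym to ≗P-sym; trans to ≗P-trans; reflexive to ≡⇒≗P)
open import Relation.Binary.Reasoning.Setoid setoid
open import Data.List.Relation.Binary.Permutation.Setoid.Properties setoid using (foldr-commMonoid)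

⊕-cong : ∀ {p p′ q q′} → p ≗P p′ → q ≗P q′ → p ⊕ q ≗P p′ ⊕ q′
⊕-cong e f k = cong₂ _+_ (e k) (f k)

⊕-congˡ : ∀ p {q q′} → q ≗P q′ → p ⊕ q ≗P p ⊕ q′
⊕-congˡ p f k = cong (_+_ (p k)) (f k)

Σ : {A : Set} → (A → Poly) → List A → Poly
Σ f xs = foldr _⊕_ zeroP (map f xs)

Σ-map : {A B : Set} (f : B → Poly) (g : A → B) (xs : List A) → Σ f (map g xs) ≡ Σ (f ∘ g) xs
Σ-map f g xs = cong (foldr _⊕_ zeroP) (sym (List.map-∘ xs))

Σ-↭ : {A : Set} (f : A → Poly) {xs ys : List A} → xs ↭ ys → Σ f xs ≗P Σ f ys
Σ-↭ f p = foldr-commMonoid isCommutativeMonoid (↭⇒↭ₛ′ isEquivalence (↭.map⁺ f p))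

Σ-++ : {A : Set} (f : A → Poly) (xs ys : List A) → Σ f (xs ++ ys) ≗P Σ f xs ⊕ Σ f ys
Σ-++ f []       ys k = sym (ℤ.+-identityˡ _)
Σ-++ f (x ∷ xs) ys k = trans (cong (_+_ (f x k)) (Σ-++ f xs ys k)) (sym (ℤ.+-assoc (f x k) _ _))

Σ-concatMap : {A B : Set} (f : B → Poly) (g : A → List B) (xs : List A) →
  Σ f (concatMap g xs) ≗P Σ (Σ f ∘ g) xs
Σ-concatMap f g []       k = refl
Σ-concatMap f g (x ∷ xs) k = trans (Σ-++ f (g x) (concatMap g xs) k) (cong (_+_ (Σ f (g x) k)) (Σ-concatMap f g xs k))

Σ-cong∈ : {A : Set} {f g : A → Poly} (xs : List A) → (∀ {x} → x ∈ xs → f x ≗P g x) → Σ f xs ≗P Σ g xs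
Σ-cong∈ []       eq k = refl
Σ-cong∈ (x ∷ xs) eq   = ⊕-cong (eq (here refl)) (Σ-cong∈ xs (λ x∈ → eq (there x∈)))

Σ-cong : {A : Set} {f g : A → Poly} → (∀ x → f x ≗P g x) → ∀ xs → Σ f xs ≗P Σ g xs
Σ-cong eq xs = Σ-cong∈ xs (λ {x} _ → eq x)

Σ-⊕ : {A : Set} (f g : A → Poly) (xs : List A) → Σ (λ x → f x ⊕ g x) xs ≗P Σ f xs ⊕ Σ g xs
Σ-⊕ f g []       k = refl
Σ-⊕ f g (x ∷ xs) k = trans (cong (_+_ (f x k + g x k)) (Σ-⊕ f g xs k)) (swap (f x k) (g x k) _ _)
  where
  swap : ∀ a b c d → a + b + (c + d) ≡ a + c + (b + d)
  swap = solve-∀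

-- Linear operators on polynomials

record Linear (F : Poly → Poly) : Set where
  field
    cong-≗ : ∀ {p q} → p ≗P q → F p ≗P F q
    map-⊕  : ∀ p q → F (p ⊕ q) ≗P F p ⊕ F q
    map-0  : F zeroP ≗P zeroP

  Σ-comm : {A : Set} (f : A → Poly) (xs : List A) → F (Σ f xs) ≗P Σ (F ∘ f) xs
  Σ-comm f []       = map-0
  Σ-comm f (x ∷ xs) k = trans (map-⊕ (f x) (Σ f xs) k) (⊕-congˡ (F (f x)) (Σ-comm f xs) k)

open Linear

id-linear : Linear id
id-linear = record { cong-≗ = id ; map-⊕ = λ _ _ _ → refl ; map-0 = λ _ → refl }

X*-linear : Linear X*
X*-linear = record { cong-≗ = cong-X* ; map-⊕ = ⊕-X* ; map-0 = 0-X* }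
  where
  cong-X* : ∀ {p q} → p ≗P q → X* p ≗P X* q
  cong-X* eq zero    = refl
  cong-X* eq (suc k) = eq k
  ⊕-X* : ∀ p q → X* (p ⊕ q) ≗P X* p ⊕ X* q
  ⊕-X* p q zero    = refl
  ⊕-X* p q (suc k) = refl
  0-X* : X* zeroP ≗P zeroP
  0-X* zero    = refl
  0-X* (suc k) = refl

·-linear : ∀ c → Linear (c ·_)
·-linear c = record
  { cong-≗ = λ eq k → cong (c *_) (eq k)
  ; map-⊕  = λ p q k → ℤ.*-distribˡ-+ c (p k) (q k)
  ; map-0  = λ k → ℤ.*-zeroʳ c
  }

D-linear : Linear D
D-linear = record
  { cong-≗ = λ eq k → cong (+ suc k *_) (eq (suc k))
  ; map-⊕  = λ p q k → ℤ.*-distribˡ-+ (+ suc k) (p (suc k)) (q (suc k))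
  ; map-0  = λ k → ℤ.*-zeroʳ (+ suc k)
  }

∘-linear : ∀ {F G} → Linear F → Linear G → Linear (F ∘ G)
∘-linear LF LG = record
  { cong-≗ = cong-≗ LF ∘ cong-≗ LG
  ; map-⊕  = λ p q k → trans (cong-≗ LF (map-⊕ LG p q) k) (map-⊕ LF _ _ k)
  ; map-0  = λ k → trans (cong-≗ LF (map-0 LG) k) (map-0 LF k)
  }

infixl 6 _⊕ₒ_ _⊖ₒ_

_⊕ₒ_ : (Poly → Poly) → (Poly → Poly) → Poly → Poly
(F ⊕ₒ G) p = F p ⊕ G p

_⊖ₒ_ : (Poly → Poly) → (Poly → Poly) → Poly → Poly
(F ⊖ₒ G) p = F p ⊖ G p

⊕ₒ-linear : ∀ {F G} → Linear F → Linear G → Linear (F ⊕ₒ G)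
⊕ₒ-linear {F} {G} LF LG = record
  { cong-≗ = λ eq k → cong₂ _+_ (cong-≗ LF eq k) (cong-≗ LG eq k)
  ; map-⊕  = λ p q k → trans (cong₂ _+_ (map-⊕ LF p q k) (map-⊕ LG p q k)) (interchange (F p k) (F q k) (G p k) (G q k))
  ; map-0  = λ k → cong₂ _+_ (map-0 LF k) (map-0 LG k)
  }
  where
  interchange : ∀ a b c d → (a + b) + (c + d) ≡ (a + c) + (b + d)
  interchange = solve-∀

⊖ₒ-linear : ∀ {F G} → Linear F → Linear G → Linear (F ⊖ₒ G)
⊖ₒ-linear {F} {G} LF LG = record
  { cong-≗ = λ eq k → cong₂ _-_ (cong-≗ LF eq k) (cong-≗ LG eq k)
  ; map-⊕  = λ p q k → trans (cong₂ _-_ (map-⊕ LF p q k) (map-⊕ LG p q k)) (interchange (F p k) (F q k) (G p k) (G q k))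
  ; map-0  = λ k → cong₂ _-_ (map-0 LF k) (map-0 LG k)
  }
  where
  interchange : ∀ a b c d → (a + b) - (c + d) ≡ (a - c) + (b - d)
  interchange = solve-∀

Σ-linear₂ : ∀ {F G} → Linear F → Linear G → {A : Set} (f g : A → Poly) (xs : List A) →
  Σ (λ x → F (f x) ⊕ G (g x)) xs ≗P F (Σ f xs) ⊕ G (Σ g xs)
Σ-linear₂ {F} {G} LF LG f g xs k =
  trans (Σ-⊕ (F ∘ f) (G ∘ g) xs k) (sym (⊕-cong (Σ-comm LF f xs) (Σ-comm LG g xs) k))

θ : Poly → Poly
θ p = (+ 2) · X* (D p ⊖ X* (D p))

recE : ℕ → Poly → Poly → Poly
recE n e o = (+ (2 ℕ.* n)) · X* e ⊕ θ e ⊕ X* o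

recO : ℕ → Poly → Poly → Poly
recO n e o = ((+ (2 ℕ.* n ∸ 1)) · X* o ⊕ o) ⊕ θ o ⊕ e

θ-linear : Linear θ
θ-linear = ∘-linear (·-linear (+ 2)) (∘-linear X*-linear (∘-linear (⊖ₒ-linear id-linear X*-linear) D-linear))

recE-linear : ∀ n → Linear (((+ (2 ℕ.* n)) ·_) ∘ X* ⊕ₒ θ)
recE-linear n = ⊕ₒ-linear (∘-linear (·-linear (+ (2 ℕ.* n))) X*-linear) θ-linear

recO-linear : ∀ n → Linear (((((+ (2 ℕ.* n ∸ 1)) ·_) ∘ X*) ⊕ₒ id) ⊕ₒ θ)
recO-linear n = ⊕ₒ-linear (⊕ₒ-linear (∘-linear (·-linear (+ (2 ℕ.* n ∸ 1))) X*-linear) id-linear) θ-linear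

Σ-recE : ∀ n {A : Set} (e o : A → Poly) (xs : List A) → Σ (λ x → recE n (e x) (o x)) xs ≗P recE n (Σ e xs) (Σ o xs)
Σ-recE n = Σ-linear₂ (recE-linear n) X*-linear

Σ-recO : ∀ n {A : Set} (e o : A → Poly) (xs : List A) → Σ (λ x → recO n (e x) (o x)) xs ≗P recO n (Σ e xs) (Σ o xs)
Σ-recO n e o = Σ-linear₂ (recO-linear n) id-linear o e

recE-cong : ∀ n {e e′ o o′} → e ≗P e′ → o ≗P o′ → recE n e o ≗P recE n e′ o′
recE-cong n e o = ⊕-cong (cong-≗ (recE-linear n) e) (cong-≗ X*-linear o)

recO-cong : ∀ n {e e′ o o′} → e ≗P e′ → o ≗P o′ → recO n e o ≗P recO n e′ o′
recO-cong n e o = ⊕-cong (cong-≗ (recO-linear n) o) e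

x^_ : ℕ → Poly
(x^ e) k = if e ≡ᵇ k then + 1 else + 0

X*-x^ : ∀ e → X* (x^ e) ≗P x^ suc e
X*-x^ e zero    = refl
X*-x^ e (suc k) = refl

X*-D-coeff : ∀ p k → X* (D p) k ≡ + k * p k
X*-D-coeff p zero    = refl
X*-D-coeff p (suc k) = refl

x^-scale : ∀ e k → + k * (x^ e) k ≡ + e * (x^ e) k
x^-scale e k with e ≡ᵇ k in eq
... | true  = cong (λ i → + i * + 1) (sym (≡ᵇ-sound {e} {k} eq))
... | false = trans (ℤ.*-zeroʳ (+ k)) (sym (ℤ.*-zeroʳ (+ e)))

θ-x^ : ∀ e → θ (x^ e) ≗P (+ 2 * + e) · (x^ e ⊖ x^ suc e)
θ-x^ e zero = sym (trans (expand (+ e) ((x^ e) 0)) (cong (λ t → + 2 * t) (sym (x^-scale e 0))))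
  where
  expand : ∀ a u → (+ 2 * a) * (u - + 0) ≡ + 2 * (a * u)
  expand = solve-∀
θ-x^ e (suc j) =
  trans (cong₂ (λ a b → + 2 * (a - b)) (x^-scale e (suc j)) (trans (X*-D-coeff (x^ e) j) (x^-scale e j)))
        (factor (+ e) ((x^ e) (suc j)) ((x^ e) j))
  where
  factor : ∀ a u w → + 2 * (a * u - a * w) ≡ (+ 2 * a) * (u - w)
  factor = solve-∀

-- Of the L places where a plateau of a new maximum can be inserted, the 2A next to an
-- ascent-plateau leave ap unchanged and the other L − 2A raise it by one.
slots : ℕ → ℕ → Poly
slots A L = (+ 2 * + A) · x^ A ⊕ (+ L - + 2 * + A) · x^ suc A

slots-extend : ∀ A L → x^ suc A ⊕ slots A L ≗P slots A (suc L)
slots-extend A L k =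
  trans (ring (+ A) (+ L) ((x^ A) k) ((x^ suc A) k))
        (cong (λ l → (+ 2 * + A) * (x^ A) k + (l - + 2 * + A) * (x^ suc A) k) (sym (ℤ.pos-+ 1 L)))
  where
  ring : ∀ a l u v → v + ((+ 2 * a) * u + (l - + 2 * a) * v) ≡ (+ 2 * a) * u + ((+ 1 + l) - + 2 * a) * v
  ring = solve-∀

slots-extend-plateau : ∀ A L → x^ suc A ⊕ (x^ suc A ⊕ X* (slots A L ⊖ x^ suc A)) ≗P slots (suc A) (suc L)
slots-extend-plateau A L zero = ring (+ suc A) (+ suc L)
  where
  ring : ∀ a l → + 0 + (+ 0 + + 0) ≡ (+ 2 * a) * + 0 + (l - + 2 * a) * + 0
  ring = solve-∀
slots-extend-plateau A L (suc j) =
  trans (ring (+ A) (+ L) ((x^ A) j) ((x^ suc A) j))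
        (cong₂ (λ a l → (+ 2 * a) * (x^ A) j + (l - + 2 * a) * (x^ suc A) j) (sym (ℤ.pos-+ 1 A)) (sym (ℤ.pos-+ 1 L)))
  where
  ring : ∀ a l w v → w + (w + ((+ 2 * a) * w + (l - + 2 * a) * v - v))
                   ≡ (+ 2 * (+ 1 + a)) * w + ((+ 1 + l) - + 2 * (+ 1 + a)) * v
  ring = solve-∀

⊕-cancelˡ : ∀ {p q r} → p ⊕ q ≗P r → q ≗P r ⊖ p
⊕-cancelˡ {p} {q} eq k = trans (cancel (p k) (q k)) (cong (_- p k) (eq k))
  where
  cancel : ∀ a b → b ≡ (a + b) - a
  cancel = solve-∀

recE-zero : ∀ n o → recE n zeroP o ≗P X* o
recE-zero n o k = trans (cong (_+ X* o k) (map-0 (recE-linear n) k)) (ℤ.+-identityˡ (X* o k))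

recO-zero : ∀ n e → recO n e zeroP ≗P e
recO-zero n e k = trans (cong (_+ e k) (map-0 (recO-linear n) k)) (ℤ.+-identityˡ (e k))

recE-x^ : ∀ n A → recE n (x^ A) zeroP ≗P slots A (2 ℕ.* n)
recE-x^ n A zero    = trans (cong (λ t → + (2 ℕ.* n) * + 0 + t + + 0) (θ-x^ A zero))
                            (ring (+ (2 ℕ.* n)) (+ A) ((x^ A) 0))
  where
  ring : ∀ c a u → c * + 0 + (+ 2 * a) * (u - + 0) + + 0 ≡ (+ 2 * a) * u + (c - + 2 * a) * + 0
  ring = solve-∀
recE-x^ n A (suc j) = trans (cong (λ t → + (2 ℕ.* n) * (x^ A) j + t + + 0) (θ-x^ A (suc j)))
                            (ring (+ (2 ℕ.* n)) (+ A) ((x^ A) (suc j)) ((x^ A) j))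
  where
  ring : ∀ c a u w → c * w + (+ 2 * a) * (u - w) + + 0 ≡ (+ 2 * a) * u + (c - + 2 * a) * w
  ring = solve-∀

pred-double : ∀ n → 1 ≤ n → + (2 ℕ.* n ∸ 1) ≡ + (2 ℕ.* n) - + 1
pred-double n n≥1 = trans (add-sub (+ (2 ℕ.* n ∸ 1)))
  (cong (_- + 1) (trans (sym (ℤ.pos-+ (2 ℕ.* n ∸ 1) 1)) (cong +_ (ℕ.m∸n+n≡m (ℕ.≤-trans n≥1 (ℕ.m≤m+n n _))))))
  where
  add-sub : ∀ a → a ≡ (a + + 1) - + 1
  add-sub = solve-∀

recO-x^ : ∀ n A → 1 ≤ n → recO n zeroP (x^ A) ≗P x^ A ⊕ (slots A (2 ℕ.* n) ⊖ x^ suc A)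
recO-x^ n A _   zero    = trans (cong (λ t → + (2 ℕ.* n ∸ 1) * + 0 + (x^ A) 0 + t + + 0) (θ-x^ A zero))
                                (ring (+ (2 ℕ.* n ∸ 1)) (+ (2 ℕ.* n)) (+ A) ((x^ A) 0))
  where
  ring : ∀ c l a u → c * + 0 + u + (+ 2 * a) * (u - + 0) + + 0 ≡ u + ((+ 2 * a) * u + (l - + 2 * a) * + 0 - + 0)
  ring = solve-∀
recO-x^ n A n≥1 (suc j) =
  trans (cong₂ (λ c t → c * (x^ A) j + (x^ A) (suc j) + t + + 0) (pred-double n n≥1) (θ-x^ A (suc j)))
        (ring (+ (2 ℕ.* n)) (+ A) ((x^ A) (suc j)) ((x^ A) j))
  where
  ring : ∀ l a u w → (l - + 1) * w + u + (+ 2 * a) * (u - w) + + 0 ≡ u + ((+ 2 * a) * u + (l - + 2 * a) * w - w)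
  ring = solve-∀

-- Ascent-plateaux and plateau insertion

ap-plateau-head : ∀ m w → ap (m ∷ m ∷ w) ≡ ap (m ∷ w)
ap-plateau-head m []      = refl
ap-plateau-head m (d ∷ w) rewrite <ᵇ-false (ℕ.≤-refl {m}) = refl

ap-descent : ∀ {m b} w → b < m → ap (m ∷ b ∷ w) ≡ ap (b ∷ w)
ap-descent []      b<m = refl
ap-descent (d ∷ w) b<m rewrite <ᵇ-false (ℕ.<⇒≤ b<m) = refl

ap-initial-plateau : ∀ {m a} w → a < m → ap (m ∷ m ∷ a ∷ w) ≡ ap (a ∷ w)
ap-initial-plateau {m} {a} w a<m = trans (ap-plateau-head m (a ∷ w)) (ap-descent w a<m)

ap-no-plateau : ∀ {c b d} w → b ≢ d → ap (c ∷ b ∷ d ∷ w) ≡ ap (b ∷ d ∷ w)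
ap-no-plateau {c} {b} w b≢d rewrite ≡ᵇ-false b≢d | ∧-zeroʳ (c <ᵇ b) = refl

ap-new-plateau : ∀ {c m} w → c < m → ap (c ∷ m ∷ m ∷ w) ≡ suc (ap (m ∷ w))
ap-new-plateau {m = m} w c<m rewrite <ᵇ-true c<m | ≡ᵇ-refl m = cong suc (ap-plateau-head m w)

ap-prefix : ∀ c b d w → (c <ᵇ b) ∧ (b ≡ᵇ d) ≡ false → ap (c ∷ b ∷ d ∷ w) ≡ ap (b ∷ d ∷ w)
ap-prefix c b d w eq = cong (λ α → (if α then 1 else 0) ℕ.+ ap (b ∷ d ∷ w)) eq

ap-prefix-plateau : ∀ c b d w → (c <ᵇ b) ∧ (b ≡ᵇ d) ≡ true → ap (c ∷ b ∷ d ∷ w) ≡ suc (ap (b ∷ d ∷ w))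
ap-prefix-plateau c b d w eq = cong (λ α → (if α then 1 else 0) ℕ.+ ap (b ∷ d ∷ w)) eq

ap-split-plateau : ∀ {a m} v → a < m → ap (a ∷ m ∷ m ∷ a ∷ v) ≡ suc (ap (a ∷ a ∷ v))
ap-split-plateau {a} v a<m = trans (ap-new-plateau (a ∷ v) a<m) (cong suc (trans (ap-descent v a<m) (sym (ap-plateau-head a v))))

insertions : ℕ → List ℕ → List (List ℕ)
insertions m []      = (m ∷ m ∷ []) ∷ []
insertions m (a ∷ v) = (m ∷ m ∷ a ∷ v) ∷ map (a ∷_) (insertions m v)

Σ-insertions-∷ : ∀ (f : List ℕ → Poly) m a v →
  Σ f (insertions m (a ∷ v)) ≡ f (m ∷ m ∷ a ∷ v) ⊕ Σ (f ∘ (a ∷_)) (insertions m v)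
Σ-insertions-∷ f m a v = cong (f (m ∷ m ∷ a ∷ v) ⊕_) (Σ-map f (a ∷_) (insertions m v))

Σ-x^-ap-insertions-step : ∀ {m} c b v → b < m →
  Σ (λ w → x^ ap (b ∷ w)) (insertions m v) ≗P slots (ap (b ∷ v)) (suc (length v)) →
  x^ suc (ap (b ∷ v)) ⊕ Σ (λ w → x^ ap (c ∷ b ∷ w)) (insertions m v)
    ≗P slots (ap (c ∷ b ∷ v)) (suc (suc (length v)))
Σ-x^-ap-insertions-step {m} c b [] b<m IH = begin
  x^ 1 ⊕ (x^ ap (c ∷ b ∷ m ∷ m ∷ []) ⊕ zeroP)
    ≡⟨ cong (λ a → x^ 1 ⊕ (x^ a ⊕ zeroP)) (ap-no-plateau (m ∷ []) (ℕ.<⇒≢ b<m)) ⟩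
  x^ 1 ⊕ (x^ ap (b ∷ m ∷ m ∷ []) ⊕ zeroP)
    ≈⟨ ⊕-congˡ (x^ 1) IH ⟩
  x^ 1 ⊕ slots 0 1
    ≈⟨ slots-extend 0 1 ⟩
  slots 0 2 ∎
Σ-x^-ap-insertions-step {m} c b (d ∷ v) b<m IH with (c <ᵇ b) ∧ (b ≡ᵇ d) in plateau
... | false = begin
  x^ suc B ⊕ Σ (λ w → x^ ap (c ∷ b ∷ w)) (insertions m (d ∷ v))
    ≡⟨ cong (x^ suc B ⊕_) (Σ-insertions-∷ (λ w → x^ ap (c ∷ b ∷ w)) m d v) ⟩
  x^ suc B ⊕ (x^ ap (c ∷ b ∷ m ∷ m ∷ d ∷ v) ⊕ Σ (λ w → x^ ap (c ∷ b ∷ d ∷ w)) (insertions m v))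
    ≈⟨ ⊕-congˡ (x^ suc B) (⊕-cong (≡⇒≗P (cong x^_ (ap-no-plateau (m ∷ d ∷ v) (ℕ.<⇒≢ b<m))))
                                  (Σ-cong (λ w → ≡⇒≗P (cong x^_ (ap-prefix c b d w plateau))) (insertions m v))) ⟩
  x^ suc B ⊕ (x^ ap (b ∷ m ∷ m ∷ d ∷ v) ⊕ Σ (λ w → x^ ap (b ∷ d ∷ w)) (insertions m v))
    ≡⟨ cong (x^ suc B ⊕_) (sym (Σ-insertions-∷ (λ w → x^ ap (b ∷ w)) m d v)) ⟩
  x^ suc B ⊕ Σ (λ w → x^ ap (b ∷ w)) (insertions m (d ∷ v))
    ≈⟨ ⊕-congˡ (x^ suc B) IH ⟩
  x^ suc B ⊕ slots B (suc (suc (length v)))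
    ≈⟨ slots-extend B _ ⟩
  slots B (suc (suc (suc (length v)))) ∎
  where
  B = ap (b ∷ d ∷ v)
... | true with ≡ᵇ-sound {b} {d} (∧-conicalʳ (c <ᵇ b) (b ≡ᵇ d) plateau)
-- The plateau b b becomes an ascent-plateau; only the insertion that splits it destroys it.
... | refl = begin
  x^ suc B ⊕ Σ (λ w → x^ ap (c ∷ b ∷ w)) (insertions m (b ∷ v))
    ≡⟨ cong (x^ suc B ⊕_) (Σ-insertions-∷ (λ w → x^ ap (c ∷ b ∷ w)) m b v) ⟩
  x^ suc B ⊕ (x^ ap (c ∷ b ∷ m ∷ m ∷ b ∷ v) ⊕ Σ (λ w → x^ ap (c ∷ b ∷ b ∷ w)) (insertions m v))
    ≈⟨ ⊕-congˡ (x^ suc B)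
         (⊕-cong (≡⇒≗P (cong x^_ (trans (ap-no-plateau (m ∷ b ∷ v) (ℕ.<⇒≢ b<m)) (ap-split-plateau v b<m))))
                  shifted) ⟩
  x^ suc B ⊕ (x^ suc B ⊕ X* Rest)
    ≈⟨ ⊕-congˡ (x^ suc B) (⊕-congˡ (x^ suc B) (cong-≗ X*-linear (⊕-cancelˡ IH′))) ⟩
  x^ suc B ⊕ (x^ suc B ⊕ X* (slots B (suc (suc (length v))) ⊖ x^ suc B))
    ≈⟨ slots-extend-plateau B _ ⟩
  slots (suc B) (suc (suc (suc (length v)))) ∎
  where
  B    = ap (b ∷ b ∷ v)
  Rest = Σ (λ w → x^ ap (b ∷ b ∷ w)) (insertions m v)
  IH′ : x^ suc B ⊕ Rest ≗P slots B (suc (suc (length v)))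
  IH′ k = trans (cong (λ a → (x^ a) k + Rest k) (sym (ap-split-plateau v b<m)))
                (trans (≡⇒≗P (sym (Σ-insertions-∷ (λ w → x^ ap (b ∷ w)) m b v)) k) (IH k))
  shifted : Σ (λ w → x^ ap (c ∷ b ∷ b ∷ w)) (insertions m v) ≗P X* Rest
  shifted = ≗P-trans (Σ-cong (λ w → ≗P-trans (≡⇒≗P (cong x^_ (ap-prefix-plateau c b b w plateau))) (≗P-sym (X*-x^ _)))
                             (insertions m v))
                     (≗P-sym (Σ-comm X*-linear (λ w → x^ ap (b ∷ b ∷ w)) (insertions m v)))

Σ-x^-ap-insertions : ∀ {m} c v → c < m → All (_< m) v →
  Σ (λ w → x^ ap (c ∷ w)) (insertions m v) ≗P slots (ap (c ∷ v)) (suc (length v))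
Σ-x^-ap-insertions {m} c [] c<m [] k =
  trans (cong (λ a → (x^ a) k + + 0) (ap-new-plateau [] c<m)) (ring ((x^ 0) k) ((x^ 1) k))
  where
  ring : ∀ u v → v + + 0 ≡ (+ 2 * + 0) * u + (+ 1 - + 2 * + 0) * v
  ring = solve-∀
Σ-x^-ap-insertions {m} c (b ∷ v) c<m (b<m ∷ v<m) = begin
  Σ (λ w → x^ ap (c ∷ w)) (insertions m (b ∷ v))
    ≡⟨ Σ-insertions-∷ (λ w → x^ ap (c ∷ w)) m b v ⟩
  x^ ap (c ∷ m ∷ m ∷ b ∷ v) ⊕ Σ (λ w → x^ ap (c ∷ b ∷ w)) (insertions m v)
    ≡⟨ cong (λ a → x^ a ⊕ Σ (λ w → x^ ap (c ∷ b ∷ w)) (insertions m v))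
            (trans (ap-new-plateau (b ∷ v) c<m) (cong suc (ap-descent v b<m))) ⟩
  x^ suc (ap (b ∷ v)) ⊕ Σ (λ w → x^ ap (c ∷ b ∷ w)) (insertions m v)
    ≈⟨ Σ-x^-ap-insertions-step c b v b<m (Σ-x^-ap-insertions b v b<m v<m) ⟩
  slots (ap (c ∷ b ∷ v)) (suc (suc (length v))) ∎
-- Stirling permutations

unique-⊆⊇⇒↭ : {A : Set} {xs ys : List A} → Unique xs → Unique ys →
  (∀ {z} → z ∈ xs → z ∈ ys) → (∀ {z} → z ∈ ys → z ∈ xs) → xs ↭ ys
unique-⊆⊇⇒↭ ux uy f g = ∼bag⇒↭ (unique∧set⇒bag ux uy (mk⇔ f g))

concatMap-unique : {A B : Set} (f : A → List B) (key : B → A) {xs : List A} → Unique xs →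
  (∀ x → x ∈ xs → Unique (f x)) → (∀ x y → x ∈ xs → y ∈ f x → key y ≡ x) → Unique (concatMap f xs)
concatMap-unique f key {[]} u uf kf = []
concatMap-unique f key {x ∷ xs} (x∉ ∷ u) uf kf =
  Unique.++⁺ (uf x (here refl)) (concatMap-unique f key u (λ x′ p → uf x′ (there p)) (λ x′ y p q → kf x′ y (there p) q))
    (λ { (y∈fx , y∈rest) → disj y∈fx y∈rest })
  where
  disj : ∀ {y} → y ∈ f x → y ∈ concatMap f xs → ⊥
  disj {y} p q with find (∈-concatMap⁻ f {xs = xs} q)
  ... | x′ , x′∈ , y∈fx′ = All¬⇒¬Any x∉ (lose x′∈ (trans (sym (kf x y (here refl) p)) (kf x′ y (there x′∈) y∈fx′)))

Letter : ℕ → ℕ → Set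
Letter n a = a ∈ map suc (upTo n)

letter⁻ : ∀ {n a} → Letter n a → 1 ≤ a × a ≤ n
letter⁻ {n} p with ∈-map⁻ suc p
... | i , i∈ , refl = s≤s z≤n , ∈-upTo⁻ i∈

letter⁺ : ∀ {n a} → 1 ≤ a → a ≤ n → Letter n a
letter⁺ {n} {suc i} _ le = ∈-map⁺ suc (∈-upTo⁺ le)

prependLetters : ℕ → List ℕ → List (List ℕ)
prependLetters n w = map (λ a → a ∷ w) (map suc (upTo n))

∈-words⁻ : ∀ n l w → w ∈ words n l → length w ≡ l × All (Letter n) w
∈-words⁻ n zero .[] (here refl) = refl , []
∈-words⁻ n (suc l) w′ p with find (∈-concatMap⁻ (prependLetters n) {xs = words n l} p)
... | w , w∈ , q with ∈-map⁻ (λ a → a ∷ w) q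
... | a , a∈ , refl with ∈-words⁻ n l w w∈
... | e , all = cong suc e , (a∈ ∷ all)

∈-words⁺ : ∀ n w → All (Letter n) w → w ∈ words n (length w)
∈-words⁺ n [] [] = here refl
∈-words⁺ n (a ∷ w) (a∈ ∷ all) = ∈-concatMap⁺ (prependLetters n) (lose (∈-words⁺ n w all) (∈-map⁺ (λ b → b ∷ w) a∈))

words-unique : ∀ n l → Unique (words n l)
words-unique n zero = [] ∷ []
words-unique n (suc l) = concatMap-unique (prependLetters n) (drop 1) (words-unique n l)
  (λ w _ → Unique.map⁺ List.∷-injectiveˡ (Unique.map⁺ ℕ.suc-injective (Unique.upTo⁺ n)))
  (λ w y _ q → kk w y q)
  where
  kk : ∀ w y → y ∈ prependLetters n w → drop 1 y ≡ w
  kk w y q with ∈-map⁻ (λ a → a ∷ w) q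
  ... | a , _ , refl = refl

all⇒All : {A : Set} (p : A → Bool) (xs : List A) → all p xs ≡ true → All (λ x → p x ≡ true) xs
all⇒All p [] _ = []
all⇒All p (x ∷ xs) e with p x in eq
... | true = eq ∷ all⇒All p xs e
all⇒All p (x ∷ xs) () | false

All⇒all : {A : Set} (p : A → Bool) (xs : List A) → All (λ x → p x ≡ true) xs → all p xs ≡ true
All⇒all p [] _ = refl
All⇒all p (x ∷ xs) (px ∷ a) rewrite px = All⇒all p xs a

any-≡ᵇ⇒∈ : ∀ a w → any (λ b → b ≡ᵇ a) w ≡ true → a ∈ w
any-≡ᵇ⇒∈ a [] ()
any-≡ᵇ⇒∈ a (b ∷ w) e with b ≡ᵇ a in eq
... | true = here (sym (≡ᵇ-sound eq))
... | false = there (any-≡ᵇ⇒∈ a w e)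

∈⇒any-≡ᵇ : ∀ a w → a ∈ w → any (λ b → b ≡ᵇ a) w ≡ true
∈⇒any-≡ᵇ a (b ∷ w) (here refl) rewrite ≡ᵇ-refl a = refl
∈⇒any-≡ᵇ a (b ∷ w) (there p) with b ≡ᵇ a
... | true = refl
... | false = ∈⇒any-≡ᵇ a w p

beforeNext : ℕ → List ℕ → List ℕ
beforeNext a w = takeWhileB (λ b → not (b ≡ᵇ a)) w

Stirling : List ℕ → Set
Stirling [] = ⊤
Stirling (a ∷ w) = (a ∈ w → All (a <_) (beforeNext a w)) × Stirling w

all-<ᵇ⇒All : ∀ a xs → all (λ b → a <ᵇ b) xs ≡ true → All (a <_) xs
all-<ᵇ⇒All a xs e = All.map <ᵇ-sound (all⇒All _ xs e)

All⇒all-<ᵇ : ∀ a xs → All (a <_) xs → all (λ b → a <ᵇ b) xs ≡ true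
All⇒all-<ᵇ a xs al = All⇒all _ xs (All.map <ᵇ-true al)

∧-true⁺ : ∀ {x y} → x ≡ true → y ≡ true → (x ∧ y) ≡ true
∧-true⁺ refl refl = refl

stirlingCond⇒Stirling : ∀ w → stirlingCond w ≡ true → Stirling w
stirlingCond⇒Stirling [] _ = tt
stirlingCond⇒Stirling (a ∷ w) e = f , stirlingCond⇒Stirling w (∧-conicalʳ _ _ e)
  where
  f : a ∈ w → All (a <_) (beforeNext a w)
  f a∈ = all-<ᵇ⇒All a (beforeNext a w)
    (subst (λ t → (if t then all (λ b → a <ᵇ b) (beforeNext a w) else true) ≡ true) (∈⇒any-≡ᵇ a w a∈) (∧-conicalˡ _ _ e))

Stirling⇒stirlingCond : ∀ w → Stirling w → stirlingCond w ≡ true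
Stirling⇒stirlingCond [] _ = refl
Stirling⇒stirlingCond (a ∷ w) (f , s) = ∧-true⁺ g (Stirling⇒stirlingCond w s)
  where
  g : (if any (λ b → b ≡ᵇ a) w then all (λ b → a <ᵇ b) (beforeNext a w) else true) ≡ true
  g with any (λ b → b ≡ᵇ a) w in eq
  ... | true = All⇒all-<ᵇ a (beforeNext a w) (f (any-≡ᵇ⇒∈ a w eq))
  ... | false = refl

TwiceEach : ℕ → List ℕ → Set
TwiceEach n w = ∀ i → Letter n i → occ i w ≡ 2

isMultisetPerm⇒TwiceEach : ∀ n w → isMultisetPerm n w ≡ true → TwiceEach n w
isMultisetPerm⇒TwiceEach n w e i i∈ = ≡ᵇ-sound (All.lookup (all⇒All _ _ e) i∈)

TwiceEach⇒isMultisetPerm : ∀ n w → TwiceEach n w → isMultisetPerm n w ≡ true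
TwiceEach⇒isMultisetPerm n w f = All⇒all _ _ (All.tabulate (λ {i} i∈ → subst (λ z → (z ≡ᵇ 2) ≡ true) (sym (f i i∈)) refl))

record StirlingPerm (n : ℕ) (w : List ℕ) : Set where
  field
    length≡ : length w ≡ 2 ℕ.* n
    letters : All (Letter n) w
    twice : TwiceEach n w
    stirling : Stirling w

∈-Q⁻ : ∀ n w → w ∈ Q n → StirlingPerm n w
∈-Q⁻ n w p with ∈-filter⁻ (λ w → T? (isStirling n w)) {xs = words n (2 ℕ.* n)} p
... | w∈ , t with ∈-words⁻ n (2 ℕ.* n) w w∈
... | l , a = record
  { length≡  = l
  ; letters  = a
  ; twice    = isMultisetPerm⇒TwiceEach n w (∧-conicalˡ _ _ (to T-≡ t))
  ; stirling = stirlingCond⇒Stirling w (∧-conicalʳ _ _ (to T-≡ t))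
  }

∈-Q⁺ : ∀ n w → StirlingPerm n w → w ∈ Q n
∈-Q⁺ n w iq = ∈-filter⁺ (λ w → T? (isStirling n w)) (subst (λ l → w ∈ words n l) length≡ (∈-words⁺ n w letters))
   (from T-≡ (∧-true⁺ (TwiceEach⇒isMultisetPerm n w twice) (Stirling⇒stirlingCond w stirling)))
  where open StirlingPerm iq

Q-unique : ∀ n → Unique (Q n)
Q-unique n = Unique.filter⁺ (λ w → T? (isStirling n w)) (words-unique n (2 ℕ.* n))

insertions-length : ∀ m v w → w ∈ insertions m v → length w ≡ suc (suc (length v))
insertions-length m [] w (here refl) = refl
insertions-length m (a ∷ v) w (here refl) = refl
insertions-length m (a ∷ v) w (there p) with ∈-map⁻ (a ∷_) p
... | w′ , w′∈ , refl = cong suc (insertions-length m v w′ w′∈)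

∈-insertions⁻ : ∀ m v w x → w ∈ insertions m v → x ∈ w → x ≡ m ⊎ x ∈ v
∈-insertions⁻ m [] w x (here refl) (here e) = inj₁ e
∈-insertions⁻ m [] w x (here refl) (there (here e)) = inj₁ e
∈-insertions⁻ m (a ∷ v) w x (here refl) (here e) = inj₁ e
∈-insertions⁻ m (a ∷ v) w x (here refl) (there (here e)) = inj₁ e
∈-insertions⁻ m (a ∷ v) w x (here refl) (there (there q)) = inj₂ q
∈-insertions⁻ m (a ∷ v) w x (there p) q with ∈-map⁻ (a ∷_) p
∈-insertions⁻ m (a ∷ v) w x (there p) (here e) | w′ , w′∈ , refl = inj₂ (here e)
∈-insertions⁻ m (a ∷ v) w x (there p) (there q) | w′ , w′∈ , refl with ∈-insertions⁻ m v w′ x w′∈ q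
... | inj₁ e = inj₁ e
... | inj₂ r = inj₂ (there r)

∈-insertions⁺ : ∀ m v w x → w ∈ insertions m v → x ∈ v → x ∈ w
∈-insertions⁺ m (a ∷ v) w x (here refl) q = there (there q)
∈-insertions⁺ m (a ∷ v) w x (there p) q with ∈-map⁻ (a ∷_) p
∈-insertions⁺ m (a ∷ v) w x (there p) (here e) | w′ , w′∈ , refl = here e
∈-insertions⁺ m (a ∷ v) w x (there p) (there q) | w′ , w′∈ , refl = there (∈-insertions⁺ m v w′ x w′∈ q)

insertions-All : ∀ {P : ℕ → Set} m v w → w ∈ insertions m v → All P v → P m → All P w
insertions-All m v w p av pm = All.tabulate λ {x} x∈ → f x (∈-insertions⁻ m v w x p x∈)
  where
  f : ∀ x → x ≡ m ⊎ x ∈ v → _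
  f x (inj₁ refl) = pm
  f x (inj₂ q) = All.lookup av q

insertions-occ : ∀ m v w i → w ∈ insertions m v → occ i w ≡ occ i (m ∷ m ∷ v)
insertions-occ m [] w i (here refl) = refl
insertions-occ m (a ∷ v) w i (here refl) = refl
insertions-occ m (a ∷ v) w i (there p) with ∈-map⁻ (a ∷_) p
... | w′ , w′∈ , refl = trans (cong (λ z → (if i ≡ᵇ a then 1 else 0) ℕ.+ z) (insertions-occ m v w′ i w′∈))
      (r (if i ≡ᵇ a then 1 else 0) (if i ≡ᵇ m then 1 else 0) (occ i v))
  where
  r : ∀ x y o → x ℕ.+ (y ℕ.+ (y ℕ.+ o)) ≡ y ℕ.+ (y ℕ.+ (x ℕ.+ o))
  r = ℕ-Solver.solve-∀

beforeNext-insertions : ∀ m a v w → a < m → w ∈ insertions m v → All (a <_) (beforeNext a v) → All (a <_) (beforeNext a w)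
beforeNext-insertions m a [] w am (here refl) _ rewrite ≡ᵇ-false (ℕ.>⇒≢ am) = am ∷ am ∷ []
beforeNext-insertions m a (b ∷ v) w am (here refl) al rewrite ≡ᵇ-false (ℕ.>⇒≢ am) = am ∷ am ∷ al
beforeNext-insertions m a (b ∷ v) w am (there p) al with ∈-map⁻ (b ∷_) p
... | w′ , w′∈ , refl with b ≡ᵇ a
... | true = []
... | false with al
... | ab ∷ al′ = ab ∷ beforeNext-insertions m a v w′ am w′∈ al′

Stirling-plateau∷ : ∀ m v → All (_< m) v → Stirling v → Stirling (m ∷ m ∷ v)
Stirling-plateau∷ m v av sv = f , g , sv
  where
  f : m ∈ (m ∷ v) → All (m <_) (beforeNext m (m ∷ v))
  f _ rewrite ≡ᵇ-refl m = []
  g : m ∈ v → All (m <_) (beforeNext m v)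
  g q = ⊥-elim (ℕ.<-irrefl refl (All.lookup av q))

insertions-Stirling : ∀ m v w → All (_< m) v → Stirling v → w ∈ insertions m v → Stirling w
insertions-Stirling m [] w av sv (here refl) = Stirling-plateau∷ m [] av sv
insertions-Stirling m (a ∷ v) w av sv (here refl) = Stirling-plateau∷ m (a ∷ v) av sv
insertions-Stirling m (a ∷ v) w (am ∷ av) (fa , sv) (there p) with ∈-map⁻ (a ∷_) p
... | w′ , w′∈ , refl = f , insertions-Stirling m v w′ av sv w′∈
  where
  f : a ∈ w′ → All (a <_) (beforeNext a w′)
  f q with ∈-insertions⁻ m v w′ a w′∈ q
  ... | inj₁ e = ⊥-elim (ℕ.<-irrefl e am)
  ... | inj₂ r = beforeNext-insertions m a v w′ am w′∈ (fa r)

insertions-unique : ∀ m v → All (_< m) v → Unique (insertions m v)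
insertions-unique m [] _ = [] ∷ []
insertions-unique m (a ∷ v) (am ∷ av) =
  All.tabulate (λ {y} y∈ → ne y y∈) ∷ Unique.map⁺ List.∷-injectiveʳ (insertions-unique m v av)
  where
  ne : ∀ y → y ∈ map (a ∷_) (insertions m v) → (m ∷ m ∷ a ∷ v) ≢ y
  ne y y∈ e with ∈-map⁻ (a ∷_) y∈
  ... | w′ , _ , refl = ℕ.<-irrefl (sym (List.∷-injectiveˡ e)) am

erase : ℕ → List ℕ → List ℕ
erase m [] = []
erase m (a ∷ w) = if a ≡ᵇ m then erase m w else a ∷ erase m w

erase-absent : ∀ m v → All (_< m) v → erase m v ≡ v
erase-absent m [] _ = refl
erase-absent m (a ∷ v) (am ∷ av) rewrite ≡ᵇ-false (ℕ.<⇒≢ am) = cong (a ∷_) (erase-absent m v av)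

erase-insertions : ∀ m v w → All (_< m) v → w ∈ insertions m v → erase m w ≡ v
erase-insertions m [] w av (here refl) rewrite ≡ᵇ-refl m = refl
erase-insertions m (a ∷ v) w av (here refl) rewrite ≡ᵇ-refl m = erase-absent m (a ∷ v) av
erase-insertions m (a ∷ v) w (am ∷ av) (there p) with ∈-map⁻ (a ∷_) p
... | w′ , w′∈ , refl rewrite ≡ᵇ-false (ℕ.<⇒≢ am) = cong (a ∷_) (erase-insertions m v w′ av w′∈)

++-∈-insertions : ∀ m p s → (p ++ m ∷ m ∷ s) ∈ insertions m (p ++ s)
++-∈-insertions m [] [] = here refl
++-∈-insertions m [] (x ∷ s) = here refl
++-∈-insertions m (a ∷ p) s = there (∈-map⁺ (a ∷_) (++-∈-insertions m p s))

occ≡1⇒∈ : ∀ m w → occ m w ≡ 1 → m ∈ w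
occ≡1⇒∈ m (a ∷ w) e with m ≡ᵇ a in eq
... | true = here (≡ᵇ-sound eq)
... | false = there (occ≡1⇒∈ m w e)

plateau-split : ∀ m w → Stirling w → All (_≤ m) w → occ m w ≡ 2 → ∃₂ λ p s → w ≡ p ++ m ∷ m ∷ s
plateau-split m (a ∷ w) (fa , sw) (am ∷ aw) e with m ≡ᵇ a in eq
plateau-split m (a ∷ w) (fa , sw) (am ∷ aw) e | false with plateau-split m w sw aw e
... | p , s , refl = a ∷ p , s , refl
plateau-split m (a ∷ w) (fa , sw) (am ∷ aw) e | true with ≡ᵇ-sound {m} {a} eq
plateau-split m (a ∷ (b ∷ w)) (fa , sw) (am ∷ bm ∷ aw) e | true | refl with b ≡ᵇ m in eqb
... | true rewrite ≡ᵇ-sound {b} {m} eqb = [] , w , refl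
... | false with fa (occ≡1⇒∈ m (b ∷ w) (ℕ.suc-injective e))
... | mb ∷ _ = ⊥-elim (ℕ.<-irrefl refl (ℕ.<-≤-trans mb bm))
plateau-split m (a ∷ []) (fa , sw) (am ∷ aw) () | true | refl

beforeNext-remove-plateau : ∀ m a p s → a ≢ m → All (a <_) (beforeNext a (p ++ m ∷ m ∷ s)) → All (a <_) (beforeNext a (p ++ s))
beforeNext-remove-plateau m a [] s am al with m ≡ᵇ a in eq
... | true = ⊥-elim (am (sym (≡ᵇ-sound eq)))
... | false with al
... | _ ∷ _ ∷ al′ = al′
beforeNext-remove-plateau m a (b ∷ p) s am al with b ≡ᵇ a
... | true = []
... | false with al
... | x ∷ al′ = x ∷ beforeNext-remove-plateau m a p s am al′

Stirling-remove-plateau : ∀ m p s → All (_≢ m) p → Stirling (p ++ m ∷ m ∷ s) → Stirling (p ++ s)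
Stirling-remove-plateau m [] s _ (_ , _ , ss) = ss
Stirling-remove-plateau m (a ∷ p) s (am ∷ ap) (fa , sp) = f , Stirling-remove-plateau m p s ap sp
  where
  f : a ∈ p ++ s → All (a <_) (beforeNext a (p ++ s))
  f q = beforeNext-remove-plateau m a p s am (fa (∈-insertions⁺ m (p ++ s) _ a (++-∈-insertions m p s) q))

letter< : ∀ {n a} → Letter n a → a < suc n
letter< l = s≤s (proj₂ (letter⁻ l))

occ-absent : ∀ m v → All (_< m) v → occ m v ≡ 0
occ-absent m [] _ = refl
occ-absent m (a ∷ v) (am ∷ av) rewrite ≡ᵇ-false (ℕ.>⇒≢ am) = occ-absent m v av

occ-plateau : ∀ m v → occ m (m ∷ m ∷ v) ≡ suc (suc (occ m v))
occ-plateau m v rewrite ≡ᵇ-refl m = refl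

occ-plateau-other : ∀ {i m} v → i ≢ m → occ i (m ∷ m ∷ v) ≡ occ i v
occ-plateau-other v i≢m rewrite ≡ᵇ-false i≢m = refl

∈⇒occ≢0 : ∀ {m v} → m ∈ v → occ m v ≢ 0
∈⇒occ≢0 {m} (here refl) rewrite ≡ᵇ-refl m = λ ()
∈⇒occ≢0 {m} {a ∷ v} (there p) with m ≡ᵇ a
... | true  = λ ()
... | false = ∈⇒occ≢0 p

2+2*n : ∀ n → suc (suc (2 ℕ.* n)) ≡ 2 ℕ.* suc n
2+2*n = ℕ-Solver.solve-∀

letter-suc : ∀ {n a} → Letter n a → Letter (suc n) a
letter-suc l with letter⁻ l
... | 1≤a , a≤n = letter⁺ 1≤a (ℕ.m≤n⇒m≤1+n a≤n)

letter-max : ∀ n → Letter (suc n) (suc n)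
letter-max n = letter⁺ (s≤s z≤n) ℕ.≤-refl

letter-pred : ∀ {n a} → Letter (suc n) a → a ≢ suc n → Letter n a
letter-pred l a≢m with letter⁻ l
... | 1≤a , a≤m = letter⁺ 1≤a (ℕ.≤-pred (ℕ.≤∧≢⇒< a≤m a≢m))

letters< : ∀ {n} v → All (Letter n) v → All (_< suc n) v
letters< v a = All.map letter< a

insertions⊆Q : ∀ n w → w ∈ concatMap (insertions (suc n)) (Q n) → w ∈ Q (suc n)
insertions⊆Q n w p with find (∈-concatMap⁻ (insertions (suc n)) {xs = Q n} p)
... | v , v∈ , w∈ = ∈-Q⁺ (suc n) w (record { length≡ = length≡′ ; letters = letters′ ; twice = twice′ ; stirling = stirling′ })
  where
  m = suc n
  iq = ∈-Q⁻ n v v∈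
  open StirlingPerm iq
  av : All (_< m) v
  av = letters< v letters
  length≡′ : length w ≡ 2 ℕ.* suc n
  length≡′ = trans (insertions-length m v w w∈) (trans (cong (λ z → suc (suc z)) length≡) (2+2*n n))
  letters′ : All (Letter (suc n)) w
  letters′ = insertions-All m v w w∈ (All.map letter-suc letters) (letter-max n)
  twice′ : TwiceEach (suc n) w
  twice′ i il rewrite insertions-occ m v w i w∈ with i ℕ.≟ m
  ... | yes refl = trans (occ-plateau m v) (cong (suc ∘ suc) (occ-absent m v av))
  ... | no i≢m   = trans (occ-plateau-other v i≢m) (twice i (letter-pred il i≢m))
  stirling′ : Stirling w
  stirling′ = insertions-Stirling m v w av stirling w∈

Q-suc-split : ∀ n {w} → w ∈ Q (suc n) → ∃₂ λ p s → w ≡ p ++ suc n ∷ suc n ∷ s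
Q-suc-split n w∈ = plateau-split (suc n) _ stirling (All.map (proj₂ ∘ letter⁻) letters) (twice (suc n) (letter-max n))
  where open StirlingPerm (∈-Q⁻ (suc n) _ w∈)

Q⊆insertions : ∀ n w → w ∈ Q (suc n) → w ∈ concatMap (insertions (suc n)) (Q n)
Q⊆insertions n w w∈ with Q-suc-split n w∈
... | p , s , refl = ∈-concatMap⁺ (insertions m) (lose (∈-Q⁺ n v v-perm) w∈insertions)
  where
  m = suc n
  open StirlingPerm (∈-Q⁻ m _ w∈)
  v = p ++ s
  w∈insertions : (p ++ m ∷ m ∷ s) ∈ insertions m v
  w∈insertions = ++-∈-insertions m p s
  occ-m : occ m v ≡ 0
  occ-m = ℕ.suc-injective (ℕ.suc-injective
    (trans (sym (occ-plateau m v)) (trans (sym (insertions-occ m v _ m w∈insertions)) (twice m (letter-max n)))))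
  m∉v : ∀ {x} → x ∈ v → x ≢ m
  m∉v x∈ refl = ∈⇒occ≢0 x∈ occ-m
  v-perm : StirlingPerm n v
  v-perm = record
    { length≡  = ℕ.suc-injective (ℕ.suc-injective
                   (trans (sym (insertions-length m v _ w∈insertions)) (trans length≡ (sym (2+2*n n)))))
    ; letters  = All.tabulate λ x∈ → letter-pred (All.lookup letters (∈-insertions⁺ m v _ _ w∈insertions x∈)) (m∉v x∈)
    ; twice    = λ i i∈ → trans (sym (trans (insertions-occ m v _ i w∈insertions) (occ-plateau-other v (ℕ.<⇒≢ (letter< i∈)))))
                                (twice i (letter-suc i∈))
    ; stirling = Stirling-remove-plateau m p s (All.tabulate λ x∈ → m∉v (∈-++⁺ˡ x∈)) stirling
    }

Q-suc↭ : ∀ n → Q (suc n) ↭ concatMap (insertions (suc n)) (Q n)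
Q-suc↭ n = unique-⊆⊇⇒↭ (Q-unique (suc n))
  (concatMap-unique (insertions (suc n)) (erase (suc n)) (Q-unique n)
     (λ v v∈ → insertions-unique (suc n) v (av v v∈)) (λ v w v∈ w∈ → erase-insertions (suc n) v w (av v v∈) w∈))
  (Q⊆insertions n _) (insertions⊆Q n _)
  where
  av : ∀ v → v ∈ Q n → All (_< suc n) v
  av v v∈ = letters< v (StirlingPerm.letters (∈-Q⁻ n v v∈))

first-letters : ∀ {n v} → 1 ≤ n → v ∈ Q n → ∃₂ λ a b → ∃ λ v′ → v ≡ a ∷ b ∷ v′ × (a < b ⊎ a ≡ b)
first-letters {suc n} {v} _ v∈ with v | ∈-Q⁻ (suc n) v v∈
... | _ ∷ [] | record { length≡ = l } = ⊥-elim (ℕ.m+1+n≢0 n (sym (ℕ.suc-injective l)))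
... | a ∷ b ∷ v′ | record { letters = la ∷ _ ; twice = twice ; stirling = a-nested , _ } =
  a , b , v′ , refl , a≤b (a-nested (occ≡1⇒∈ a (b ∷ v′) occ-tail))
  where
  occ-tail : occ a (b ∷ v′) ≡ 1
  occ-tail = ℕ.suc-injective (trans (cong (λ t → (if t then 1 else 0) ℕ.+ occ a (b ∷ v′)) (sym (≡ᵇ-refl a))) (twice a la))
  a≤b : All (a <_) (beforeNext a (b ∷ v′)) → a < b ⊎ a ≡ b
  a≤b between with b ≡ᵇ a in b≟a | between
  ... | true  | _       = inj₂ (sym (≡ᵇ-sound b≟a))
  ... | false | a<b ∷ _ = inj₁ a<b


-- Generating polynomials

weight : (List ℕ → Bool) → List ℕ → Poly
weight P w = if P w then x^ ap w else zeroP

eWeight oWeight : List ℕ → Poly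
eWeight = weight firstAsc
oWeight = weight firstPlat

countWith-Σ : ∀ P ws k → + countWith P ws k ≡ Σ (weight P) ws k
countWith-Σ P []       k = refl
countWith-Σ P (w ∷ ws) k with P w | ap w ≡ᵇ k in eq
... | true  | true  = cong₂ _+_ (cong (λ t → if t then + 1 else + 0) (sym eq)) (countWith-Σ P ws k)
... | true  | false = cong₂ _+_ (cong (λ t → if t then + 1 else + 0) (sym eq)) (countWith-Σ P ws k)
... | false | _     = trans (countWith-Σ P ws k) (sym (ℤ.+-identityˡ _))

LE-Σ : ∀ n → LE n ≗P Σ eWeight (Q n)
LE-Σ n = countWith-Σ firstAsc (Q n)

LO-Σ : ∀ n → LO n ≗P Σ oWeight (Q n)
LO-Σ n = countWith-Σ firstPlat (Q n)

Σ-zeroP : {A : Set} (xs : List A) → Σ (λ _ → zeroP) xs ≗P zeroP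
Σ-zeroP []       k = refl
Σ-zeroP (x ∷ xs) k = trans (ℤ.+-identityˡ _) (Σ-zeroP xs k)

eWeight-asc : ∀ {a b} w → a < b → eWeight (a ∷ b ∷ w) ≡ x^ ap (a ∷ b ∷ w)
eWeight-asc {a} {b} w a<b = cong (λ t → if t then x^ ap (a ∷ b ∷ w) else zeroP) (<ᵇ-true a<b)

eWeight-non-asc : ∀ {a b} w → b ≤ a → eWeight (a ∷ b ∷ w) ≡ zeroP
eWeight-non-asc {a} {b} w b≤a = cong (λ t → if t then x^ ap (a ∷ b ∷ w) else zeroP) (<ᵇ-false b≤a)

oWeight-plateau : ∀ {a} w → oWeight (a ∷ a ∷ w) ≡ x^ ap (a ∷ a ∷ w)
oWeight-plateau {a} w = cong (λ t → if t then x^ ap (a ∷ a ∷ w) else zeroP) (≡ᵇ-refl a)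

oWeight-non-plateau : ∀ {a b} w → a ≢ b → oWeight (a ∷ b ∷ w) ≡ zeroP
oWeight-non-plateau {a} {b} w a≢b = cong (λ t → if t then x^ ap (a ∷ b ∷ w) else zeroP) (≡ᵇ-false a≢b)

Σ-insertions-∷∷ : ∀ (f : List ℕ → Poly) m a b v →
  Σ f (insertions m (a ∷ b ∷ v))
    ≡ f (m ∷ m ∷ a ∷ b ∷ v) ⊕ (f (a ∷ m ∷ m ∷ b ∷ v) ⊕ Σ (λ w → f (a ∷ b ∷ w)) (insertions m v))
Σ-insertions-∷∷ f m a b v =
  trans (Σ-insertions-∷ f m a (b ∷ v)) (cong (f (m ∷ m ∷ a ∷ b ∷ v) ⊕_) (Σ-insertions-∷ (f ∘ (a ∷_)) m b v))

Σ-x^-ap-insertions-∷∷ : ∀ {m} a b v → a < m → b < m → All (_< m) v →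
  x^ ap (a ∷ m ∷ m ∷ b ∷ v) ⊕ Σ (λ w → x^ ap (a ∷ b ∷ w)) (insertions m v) ≗P slots (ap (a ∷ b ∷ v)) (suc (suc (length v)))
Σ-x^-ap-insertions-∷∷ {m} a b v a<m b<m v<m =
  ≗P-trans (≡⇒≗P (sym (Σ-insertions-∷ (λ w → x^ ap (a ∷ w)) m b v))) (Σ-x^-ap-insertions a (b ∷ v) a<m (b<m ∷ v<m))

module _ {n : ℕ} (a b : ℕ) (v : List ℕ) (a<m : a < suc n) (b<m : b < suc n) (v<m : All (_< suc n) v)
         (length≡ : suc (suc (length v)) ≡ 2 ℕ.* n) where

  private
    m = suc n
    A = ap (a ∷ b ∷ v)

  Σ-eWeight-insertions-∷∷ : a < b ⊎ a ≡ b →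
    Σ eWeight (insertions m (a ∷ b ∷ v)) ≗P recE n (eWeight (a ∷ b ∷ v)) (oWeight (a ∷ b ∷ v))
  Σ-eWeight-insertions-∷∷ (inj₁ a<b) = begin
    Σ eWeight (insertions m (a ∷ b ∷ v))
      ≡⟨ Σ-insertions-∷∷ eWeight m a b v ⟩
    eWeight (m ∷ m ∷ a ∷ b ∷ v) ⊕ (eWeight (a ∷ m ∷ m ∷ b ∷ v) ⊕ Σ (λ w → eWeight (a ∷ b ∷ w)) (insertions m v))
      ≈⟨ ⊕-cong (≡⇒≗P (eWeight-non-asc {m} (a ∷ b ∷ v) ℕ.≤-refl))
                (⊕-cong (≡⇒≗P (eWeight-asc (m ∷ b ∷ v) a<m)) (Σ-cong (λ w → ≡⇒≗P (eWeight-asc w a<b)) (insertions m v))) ⟩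
    zeroP ⊕ (x^ ap (a ∷ m ∷ m ∷ b ∷ v) ⊕ Σ (λ w → x^ ap (a ∷ b ∷ w)) (insertions m v))
      ≈⟨ ⊕-congˡ zeroP (Σ-x^-ap-insertions-∷∷ a b v a<m b<m v<m) ⟩
    zeroP ⊕ slots A (suc (suc (length v)))
      ≈⟨ (λ k → ℤ.+-identityˡ _) ⟩
    slots A (suc (suc (length v)))
      ≡⟨ cong (slots A) length≡ ⟩
    slots A (2 ℕ.* n)
      ≈⟨ recE-x^ n A ⟨
    recE n (x^ A) zeroP
      ≡⟨ cong₂ (recE n) (sym (eWeight-asc v a<b)) (sym (oWeight-non-plateau v (ℕ.<⇒≢ a<b))) ⟩
    recE n (eWeight (a ∷ b ∷ v)) (oWeight (a ∷ b ∷ v)) ∎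
  Σ-eWeight-insertions-∷∷ (inj₂ refl) = begin
    Σ eWeight (insertions m (a ∷ a ∷ v))
      ≡⟨ Σ-insertions-∷∷ eWeight m a a v ⟩
    eWeight (m ∷ m ∷ a ∷ a ∷ v) ⊕ (eWeight (a ∷ m ∷ m ∷ a ∷ v) ⊕ Σ (λ w → eWeight (a ∷ a ∷ w)) (insertions m v))
      ≈⟨ ⊕-cong (≡⇒≗P (eWeight-non-asc {m} (a ∷ a ∷ v) ℕ.≤-refl))
                (⊕-cong (≡⇒≗P (trans (eWeight-asc (m ∷ a ∷ v) a<m) (cong x^_ (ap-split-plateau v a<m))))
                        (Σ-cong (λ w → ≡⇒≗P (eWeight-non-asc {a} w ℕ.≤-refl)) (insertions m v))) ⟩
    zeroP ⊕ (x^ suc A ⊕ Σ (λ _ → zeroP) (insertions m v))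
      ≈⟨ (λ k → trans (ℤ.+-identityˡ _) (trans (cong (_+_ ((x^ suc A) k)) (Σ-zeroP (insertions m v) k)) (ℤ.+-identityʳ _))) ⟩
    x^ suc A
      ≈⟨ ≗P-trans (recE-zero n (x^ A)) (X*-x^ A) ⟨
    recE n zeroP (x^ A)
      ≡⟨ cong₂ (recE n) (sym (eWeight-non-asc {a} v ℕ.≤-refl)) (sym (oWeight-plateau {a} v)) ⟩
    recE n (eWeight (a ∷ a ∷ v)) (oWeight (a ∷ a ∷ v)) ∎

  Σ-oWeight-insertions-∷∷ : 1 ≤ n → a < b ⊎ a ≡ b →
    Σ oWeight (insertions m (a ∷ b ∷ v)) ≗P recO n (eWeight (a ∷ b ∷ v)) (oWeight (a ∷ b ∷ v))
  Σ-oWeight-insertions-∷∷ _ (inj₁ a<b) = begin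
    Σ oWeight (insertions m (a ∷ b ∷ v))
      ≡⟨ Σ-insertions-∷∷ oWeight m a b v ⟩
    oWeight (m ∷ m ∷ a ∷ b ∷ v) ⊕ (oWeight (a ∷ m ∷ m ∷ b ∷ v) ⊕ Σ (λ w → oWeight (a ∷ b ∷ w)) (insertions m v))
      ≈⟨ ⊕-cong (≡⇒≗P (trans (oWeight-plateau {m} (a ∷ b ∷ v)) (cong x^_ (ap-initial-plateau (b ∷ v) a<m))))
                (⊕-cong (≡⇒≗P (oWeight-non-plateau (m ∷ b ∷ v) (ℕ.<⇒≢ a<m)))
                        (Σ-cong (λ w → ≡⇒≗P (oWeight-non-plateau w (ℕ.<⇒≢ a<b))) (insertions m v))) ⟩
    x^ A ⊕ (zeroP ⊕ Σ (λ _ → zeroP) (insertions m v))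
      ≈⟨ (λ k → trans (cong (λ t → (x^ A) k + (+ 0 + t)) (Σ-zeroP (insertions m v) k)) (ℤ.+-identityʳ _)) ⟩
    x^ A
      ≈⟨ recO-zero n (x^ A) ⟨
    recO n (x^ A) zeroP
      ≡⟨ cong₂ (recO n) (sym (eWeight-asc v a<b)) (sym (oWeight-non-plateau v (ℕ.<⇒≢ a<b))) ⟩
    recO n (eWeight (a ∷ b ∷ v)) (oWeight (a ∷ b ∷ v)) ∎
  Σ-oWeight-insertions-∷∷ n≥1 (inj₂ refl) = begin
    Σ oWeight (insertions m (a ∷ a ∷ v))
      ≡⟨ Σ-insertions-∷∷ oWeight m a a v ⟩
    oWeight (m ∷ m ∷ a ∷ a ∷ v) ⊕ (oWeight (a ∷ m ∷ m ∷ a ∷ v) ⊕ Σ (λ w → oWeight (a ∷ a ∷ w)) (insertions m v))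
      ≈⟨ ⊕-cong (≡⇒≗P (trans (oWeight-plateau {m} (a ∷ a ∷ v)) (cong x^_ (ap-initial-plateau (a ∷ v) a<m))))
                (⊕-cong (≡⇒≗P (oWeight-non-plateau (m ∷ a ∷ v) (ℕ.<⇒≢ a<m)))
                        (Σ-cong (λ w → ≡⇒≗P (oWeight-plateau {a} w)) (insertions m v))) ⟩
    x^ A ⊕ (zeroP ⊕ Rest)
      ≈⟨ ⊕-congˡ (x^ A) (λ k → ℤ.+-identityˡ (Rest k)) ⟩
    x^ A ⊕ Rest
      ≈⟨ ⊕-congˡ (x^ A) (⊕-cancelˡ Rest-slots) ⟩
    x^ A ⊕ (slots A (2 ℕ.* n) ⊖ x^ suc A)
      ≈⟨ recO-x^ n A n≥1 ⟨
    recO n zeroP (x^ A)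
      ≡⟨ cong₂ (recO n) (sym (eWeight-non-asc {a} v ℕ.≤-refl)) (sym (oWeight-plateau {a} v)) ⟩
    recO n (eWeight (a ∷ a ∷ v)) (oWeight (a ∷ a ∷ v)) ∎
    where
    Rest = Σ (λ w → x^ ap (a ∷ a ∷ w)) (insertions m v)
    Rest-slots : x^ suc A ⊕ Rest ≗P slots A (2 ℕ.* n)
    Rest-slots k = trans (cong (λ e → (x^ e) k + Rest k) (sym (ap-split-plateau v a<m)))
                         (trans (Σ-x^-ap-insertions-∷∷ a a v a<m a<m v<m k) (cong (λ L → slots A L k) length≡))

Σ-eWeight-insertions : ∀ {n v} → 1 ≤ n → v ∈ Q n → Σ eWeight (insertions (suc n) v) ≗P recE n (eWeight v) (oWeight v)
Σ-eWeight-insertions {n} n≥1 v∈ with first-letters n≥1 v∈ | ∈-Q⁻ n _ v∈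
... | a , b , v′ , refl , a≤b | record { length≡ = length≡ ; letters = la ∷ lb ∷ lv } =
  Σ-eWeight-insertions-∷∷ a b v′ (letter< la) (letter< lb) (letters< v′ lv) length≡ a≤b

Σ-oWeight-insertions : ∀ {n v} → 1 ≤ n → v ∈ Q n → Σ oWeight (insertions (suc n) v) ≗P recO n (eWeight v) (oWeight v)
Σ-oWeight-insertions {n} n≥1 v∈ with first-letters n≥1 v∈ | ∈-Q⁻ n _ v∈
... | a , b , v′ , refl , a≤b | record { length≡ = length≡ ; letters = la ∷ lb ∷ lv } =
  Σ-oWeight-insertions-∷∷ a b v′ (letter< la) (letter< lb) (letters< v′ lv) length≡ n≥1 a≤b

Σ-Q-suc : ∀ (f : List ℕ → Poly) n → Σ f (Q (suc n)) ≗P Σ (λ v → Σ f (insertions (suc n) v)) (Q n)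
Σ-Q-suc f n = ≗P-trans (Σ-↭ f (Q-suc↭ n)) (Σ-concatMap f (insertions (suc n)) (Q n))

LE-suc : ∀ n → 1 ≤ n → LE (suc n) ≗P recE n (LE n) (LO n)
LE-suc n n≥1 = begin
  LE (suc n)                                       ≈⟨ LE-Σ (suc n) ⟩
  Σ eWeight (Q (suc n))                            ≈⟨ Σ-Q-suc eWeight n ⟩
  Σ (λ v → Σ eWeight (insertions (suc n) v)) (Q n) ≈⟨ Σ-cong∈ (Q n) (Σ-eWeight-insertions n≥1) ⟩
  Σ (λ v → recE n (eWeight v) (oWeight v)) (Q n)   ≈⟨ Σ-recE n eWeight oWeight (Q n) ⟩
  recE n (Σ eWeight (Q n)) (Σ oWeight (Q n))       ≈⟨ recE-cong n (LE-Σ n) (LO-Σ n) ⟨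
  recE n (LE n) (LO n)                             ∎

LO-suc : ∀ n → 1 ≤ n → LO (suc n) ≗P recO n (LE n) (LO n)
LO-suc n n≥1 = begin
  LO (suc n)                                       ≈⟨ LO-Σ (suc n) ⟩
  Σ oWeight (Q (suc n))                            ≈⟨ Σ-Q-suc oWeight n ⟩
  Σ (λ v → Σ oWeight (insertions (suc n) v)) (Q n) ≈⟨ Σ-cong∈ (Q n) (Σ-oWeight-insertions n≥1) ⟩
  Σ (λ v → recO n (eWeight v) (oWeight v)) (Q n)   ≈⟨ Σ-recO n eWeight oWeight (Q n) ⟩
  recO n (Σ eWeight (Q n)) (Σ oWeight (Q n))       ≈⟨ recO-cong n (LE-Σ n) (LO-Σ n) ⟨
  recO n (LE n) (LO n)                             ∎

LO-1 : LO 1 ≗P oneP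
LO-1 zero    = refl
LO-1 (suc k) = refl

theorem2p5 : (∀ (n : ℕ) → 1 ≤ n →
    (LE (suc n) ≗P ((+ (2 ℕ.* n)) · X* (LE n)) ⊕ ((+ 2) · X* (D (LE n) ⊖ X* (D (LE n)))) ⊕ X* (LO n))
    × (LO (suc n) ≗P (((+ (2 ℕ.* n ∸ 1)) · X* (LO n)) ⊕ LO n) ⊕ ((+ 2) · X* (D (LO n) ⊖ X* (D (LO n)))) ⊕ LE n))
    × (LE 1 ≗P zeroP)
    × (LO 1 ≗P oneP)
theorem2p5 = (λ n n≥1 → LE-suc n n≥1 , LO-suc n n≥1) , (λ k → refl) , LO-1
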